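{- For all interfaces $X$ and $Y$, $!(X\,\&\,Y)=!X\otimes!Y$, where the state spaces are identified via the canonical bijection $\mathcal{M}_f(|X|+|Y|)\cong\mathcal{M}_f(|X|)\times\mathcal{M}_f(|Y|)$ (splitting a multiset over $|X|+|Y|$ into its $|X|$-part and its $|Y|$-part).
   Context: A monotonic predicate transformer on a set $S$ is a monotone map $P:\mathcal{P}(S)\to\mathcal{P}(S)$. An interface $X$ is a pair $(|X|,P_X)$ of a set and a monotonic predicate transformer on it. $X\otimes Y=(|X|\times|Y|,P_X\otimes P_Y)$ with $(P_X\otimes P_Y)(r)=\bigcup_{x\times y\subseteq r}P_X(x)\times P_Y(y)$ (over $x\subseteq|X|$, $y\subseteq|Y|$); $X\,\&\,Y=(|X|+|Y|,P_X\&P_Y)$ with $(P_X\&P_Y)(x,y)=(P_X(x),P_Y(y))$ under $\mathcal{P}(|X|+|Y|)\cong\mathcal{P}(|X|)\times\mathcal{P}(|Y|)$. $\mathcal{M}_f(S)$ is the set of finite multisets over $S$; for $x_1,\dots,x_n\subseteq S$, $\prod_i x_i=\{[b_1,\dots,b_n]\mid b_i\in x_i\}$. $!X=(\mathcal{M}_f(|X|),P_{!X})$ where $[a_1,\dots,a_n]\in P_{!X}(U)$ iff there exist $x_1,\dots,x_n\subseteq|X|$ with $\prod_i x_i\subseteq U$ and $a_i\in P_X(x_i)$ for all $i$. -}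

module Defs where

open import Level using (Level; _⊔_; suc)
open import Function using (_∘_)
open import Data.List using (List; []; _∷_)
open import Data.List.Relation.Binary.Pointwise using (Pointwise)
open import Data.List.Relation.Binary.Permutation.Propositional using (_↭_)
open import Data.Product using (Σ; ∃; _×_; _,_)
open import Data.Sum using (_⊎_; inj₁; inj₂)
open import Relation.Unary using (Pred; _⊆_; _∈_)

Monotone : ∀ {ℓ ℓ'} {S : Set ℓ} → (Pred S ℓ → Pred S ℓ') → Set (suc ℓ ⊔ ℓ')
Monotone P = ∀ {x y} → x ⊆ y → P x ⊆ P y

record Interface (ℓ : Level) : Set (suc ℓ) where
  field
    St   : Set ℓ
    PT   : Pred St ℓ → Pred St ℓ
    mono : Monotone PT
open Interface public

_&_ : ∀ {ℓ} → Interface ℓ → Interface ℓ → Interface ℓ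
X & Y = record { St = St X ⊎ St Y ; PT = P ; mono = m }
  where
  P : Pred (St X ⊎ St Y) _ → Pred (St X ⊎ St Y) _
  P z (inj₁ a) = PT X (z ∘ inj₁) a
  P z (inj₂ b) = PT Y (z ∘ inj₂) b
  m : Monotone P
  m x⊆y {inj₁ a} p = mono X (λ {u} q → x⊆y q) p
  m x⊆y {inj₂ b} p = mono Y (λ {u} q → x⊆y q) p

-- Finite multisets over S are represented by lists, identified up to
-- permutation (_↭_).  A predicate U on lists represents a set of multisets
-- when it is permutation-invariant.
PermInv : ∀ {ℓ ℓ'} {S : Set ℓ} → Pred (List S) ℓ' → Set (ℓ ⊔ ℓ')
PermInv U = ∀ {as bs} → as ↭ bs → U as → U bs

PermInv₂ : ∀ {ℓ ℓ'} {A B : Set ℓ} → Pred (List A × List B) ℓ' → Set (ℓ ⊔ ℓ')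
PermInv₂ r = ∀ {as as' bs bs'} → as ↭ as' → bs ↭ bs' → r (as , bs) → r (as' , bs')

Prod : ∀ {ℓ} {S : Set ℓ} → List (Pred S ℓ) → Pred (List S) (suc ℓ)
Prod xs cs = ∃ λ bs → Pointwise (λ x b → b ∈ x) xs bs × (cs ↭ bs)

bangPT : ∀ {ℓ} {S : Set ℓ} → (Pred S ℓ → Pred S ℓ) →
         Pred (List S) ℓ → Pred (List S) (suc ℓ)
bangPT P U as = ∃ λ (xs : List (Pred _ _)) →
  (∀ {cs} → Prod xs cs → U cs) × Pointwise (λ a x → a ∈ P x) as xs

tensorPT : ∀ {ℓ ℓ₁} {A B : Set ℓ} →
           (Pred A ℓ → Pred A ℓ₁) → (Pred B ℓ → Pred B ℓ₁) →
           Pred (A × B) ℓ → Pred (A × B) (suc ℓ ⊔ ℓ₁)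
tensorPT P Q r (a , b) = Σ (Pred _ _) λ x → Σ (Pred _ _) λ y →
  (∀ {a' b'} → x a' → y b' → r (a' , b')) × P x a × Q y b

split : ∀ {ℓ} {A B : Set ℓ} → List (A ⊎ B) → List A × List B
split [] = [] , []
split (inj₁ a ∷ m) with split m
... | (as , bs) = (a ∷ as) , bs
split (inj₂ b ∷ m) with split m
... | (as , bs) = as , (b ∷ bs)

-- A family x₁ … xₙ of predicates on |X| + |Y| indexed along a multiset over
-- |X| + |Y| amounts to one family indexed along its |X|-part and one indexed
-- along its |Y|-part: restrict each xᵢ to the summand of its point, or,
-- conversely, extend a predicate by the empty one on the other summand.  Under
-- this correspondence ∏ xᵢ is the product of the two split products, so the
-- products themselves serve as the predicates x, y of the tensor, and a
-- covering ∏ xᵢ ⊆ r ∘ split is the same as x × y ⊆ r.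
module Submission where

open import Defs
open import Level using (Level)
open import Function using (_∘_; _⇔_; mk⇔)
open import Data.Empty.Polymorphic using (⊥)
open import Data.Unit.Polymorphic using (⊤)
open import Data.List using (List; []; _∷_; mapMaybe)
open import Data.List.Relation.Binary.Pointwise using (Pointwise; []; _∷_)
open import Data.List.Relation.Binary.Permutation.Propositional
  using (_↭_; ↭-refl; ↭-sym)
open import Data.List.Relation.Binary.Permutation.Propositional.Properties
  using (mapMaybe-↭)
open import Data.Product using (_×_; ∃; _,_; proj₁; proj₂; map₁; map₂)
open import Data.Sum using (_⊎_; inj₁; inj₂; [_,_]′; isInj₁; isInj₂)
open import Relation.Binary.PropositionalEquality
  using (_≡_; refl; cong; subst; subst₂; sym)
open import Relation.Unary using (Pred; _⊆_; _∈_)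

private
  variable
    ℓ ℓ₁ ℓ₂ : Level
    A B : Set ℓ

-- Prod xs lives one universe above its argument predicates, whereas the
-- predicates of a tensor must be small; Box is the ordered product with the
-- list of predicates as a recursion parameter instead of a Pointwise index.
Box : {S : Set ℓ} → List (Pred S ℓ) → Pred (List S) ℓ
Box []       []       = ⊤
Box []       (_ ∷ _)  = ⊥
Box (_ ∷ _)  []       = ⊥
Box (x ∷ xs) (b ∷ bs) = b ∈ x × Box xs bs

SmallProd : {S : Set ℓ} → List (Pred S ℓ) → Pred (List S) ℓ
SmallProd xs cs = ∃ λ bs → Box xs bs × cs ↭ bs

Pointwise⇒Box : {S : Set ℓ} {xs : List (Pred S ℓ)} {bs : List S} →
                Pointwise (λ x b → b ∈ x) xs bs → Box xs bs
Pointwise⇒Box []       = _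
Pointwise⇒Box (p ∷ ps) = p , Pointwise⇒Box ps

Prod⊆SmallProd : {S : Set ℓ} {xs : List (Pred S ℓ)} → Prod xs ⊆ SmallProd xs
Prod⊆SmallProd (bs , pw , cs↭bs) = bs , Pointwise⇒Box pw , cs↭bs

proj₁-split : (m : List (A ⊎ B)) → proj₁ (split m) ≡ mapMaybe isInj₁ m
proj₁-split []           = refl
proj₁-split (inj₁ a ∷ m) = cong (a ∷_) (proj₁-split m)
proj₁-split (inj₂ b ∷ m) = proj₁-split m

proj₂-split : (m : List (A ⊎ B)) → proj₂ (split m) ≡ mapMaybe isInj₂ m
proj₂-split []           = refl
proj₂-split (inj₁ a ∷ m) = proj₂-split m
proj₂-split (inj₂ b ∷ m) = cong (b ∷_) (proj₂-split m)

PermInv₂⇒PermInv-∘split : {A B : Set ℓ} {r : Pred (List A × List B) ℓ₁} →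
                          PermInv₂ r → PermInv (r ∘ split)
PermInv₂⇒PermInv-∘split r-perm {cs} {bs} cs↭bs =
  r-perm (subst₂ _↭_ (sym (proj₁-split cs)) (sym (proj₁-split bs))
                 (mapMaybe-↭ isInj₁ cs↭bs))
         (subst₂ _↭_ (sym (proj₂-split cs)) (sym (proj₂-split bs))
                 (mapMaybe-↭ isInj₂ cs↭bs))

restrict₁ : {A B : Set ℓ} → List (A ⊎ B) → List (Pred (A ⊎ B) ℓ) → List (Pred A ℓ)
restrict₁ (inj₁ _ ∷ m) (x ∷ xs) = x ∘ inj₁ ∷ restrict₁ m xs
restrict₁ (inj₂ _ ∷ m) (_ ∷ xs) = restrict₁ m xs
restrict₁ _            _        = []

restrict₂ : {A B : Set ℓ} → List (A ⊎ B) → List (Pred (A ⊎ B) ℓ) → List (Pred B ℓ)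
restrict₂ (inj₁ _ ∷ m) (_ ∷ xs) = restrict₂ m xs
restrict₂ (inj₂ _ ∷ m) (x ∷ xs) = x ∘ inj₂ ∷ restrict₂ m xs
restrict₂ _            _        = []

merge : {A B : Set ℓ} →
        List (A ⊎ B) → List (Pred A ℓ) → List (Pred B ℓ) → List (Pred (A ⊎ B) ℓ)
merge (inj₁ _ ∷ m) (x ∷ xs) ys       = [ x , (λ _ → ⊥) ]′ ∷ merge m xs ys
merge (inj₂ _ ∷ m) xs       (y ∷ ys) = [ (λ _ → ⊥) , y ]′ ∷ merge m xs ys
merge _            _        _        = []

-- The Pointwise hypotheses with an arbitrary relation, here and below, only
-- make the lists fit together; restrict and merge truncate otherwise.
Box-restrict⇒Pointwise : {A B : Set ℓ}
  {R : A ⊎ B → Pred (A ⊎ B) ℓ → Set ℓ₂} {m : List (A ⊎ B)}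
  {xs : List (Pred (A ⊎ B) ℓ)} {as : List A} {bs : List B} →
  Pointwise R m xs →
  Box (restrict₁ m xs) as → Box (restrict₂ m xs) bs →
  ∃ λ cs → Pointwise (λ x c → c ∈ x) xs cs × split cs ≡ (as , bs)
Box-restrict⇒Pointwise {as = []} {[]} [] _ _ = [] , [] , refl
Box-restrict⇒Pointwise {m = inj₁ _ ∷ _} {as = []} (_ ∷ _) () _
Box-restrict⇒Pointwise {m = inj₂ _ ∷ _} {bs = []} (_ ∷ _) _ ()
Box-restrict⇒Pointwise {m = inj₁ _ ∷ _} {as = a ∷ _} (_ ∷ pw) (a∈x , boxX) boxY
  with cs , cs∈xs , split-cs ← Box-restrict⇒Pointwise pw boxX boxY
  = inj₁ a ∷ cs , a∈x ∷ cs∈xs , cong (map₁ (a ∷_)) split-cs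
Box-restrict⇒Pointwise {m = inj₂ _ ∷ _} {bs = b ∷ _} (_ ∷ pw) boxX (b∈y , boxY)
  with cs , cs∈xs , split-cs ← Box-restrict⇒Pointwise pw boxX boxY
  = inj₂ b ∷ cs , b∈y ∷ cs∈xs , cong (map₂ (b ∷_)) split-cs

Pointwise-merge⇒split : {A B : Set ℓ}
  {R : A → Pred A ℓ → Set ℓ₁} {R′ : B → Pred B ℓ → Set ℓ₂} {m : List (A ⊎ B)}
  {xs : List (Pred A ℓ)} {ys : List (Pred B ℓ)} {cs : List (A ⊎ B)} →
  Pointwise R (proj₁ (split m)) xs → Pointwise R′ (proj₂ (split m)) ys →
  Pointwise (λ z c → c ∈ z) (merge m xs ys) cs →
  Pointwise (λ x a → a ∈ x) xs (proj₁ (split cs)) ×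
  Pointwise (λ y b → b ∈ y) ys (proj₂ (split cs))
Pointwise-merge⇒split {m = []} [] [] [] = [] , []
Pointwise-merge⇒split {m = inj₁ _ ∷ _} {cs = inj₁ _ ∷ _}
                      (_ ∷ pwX) pwY (c∈z ∷ cs∈zs) =
  map₁ (c∈z ∷_) (Pointwise-merge⇒split pwX pwY cs∈zs)
Pointwise-merge⇒split {m = inj₂ _ ∷ _} {cs = inj₂ _ ∷ _}
                      pwX (_ ∷ pwY) (c∈z ∷ cs∈zs) =
  map₂ (c∈z ∷_) (Pointwise-merge⇒split pwX pwY cs∈zs)

module _ (X Y : Interface ℓ) where

  restrict₁-Pointwise : {m : List (St X ⊎ St Y)} {xs : List (Pred (St X ⊎ St Y) ℓ)} →
    Pointwise (λ c z → c ∈ PT (X & Y) z) m xs →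
    Pointwise (λ a x → a ∈ PT X x) (proj₁ (split m)) (restrict₁ m xs)
  restrict₁-Pointwise []                        = []
  restrict₁-Pointwise {m = inj₁ _ ∷ _} (p ∷ pw) = p ∷ restrict₁-Pointwise pw
  restrict₁-Pointwise {m = inj₂ _ ∷ _} (_ ∷ pw) = restrict₁-Pointwise pw

  restrict₂-Pointwise : {m : List (St X ⊎ St Y)} {xs : List (Pred (St X ⊎ St Y) ℓ)} →
    Pointwise (λ c z → c ∈ PT (X & Y) z) m xs →
    Pointwise (λ b y → b ∈ PT Y y) (proj₂ (split m)) (restrict₂ m xs)
  restrict₂-Pointwise []                        = []
  restrict₂-Pointwise {m = inj₁ _ ∷ _} (_ ∷ pw) = restrict₂-Pointwise pw
  restrict₂-Pointwise {m = inj₂ _ ∷ _} (p ∷ pw) = p ∷ restrict₂-Pointwise pw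

  merge-Pointwise : {m : List (St X ⊎ St Y)}
                    {xs : List (Pred (St X) ℓ)} {ys : List (Pred (St Y) ℓ)} →
    Pointwise (λ a x → a ∈ PT X x) (proj₁ (split m)) xs →
    Pointwise (λ b y → b ∈ PT Y y) (proj₂ (split m)) ys →
    Pointwise (λ c z → c ∈ PT (X & Y) z) m (merge m xs ys)
  merge-Pointwise {m = []}         []         []         = []
  merge-Pointwise {m = inj₁ _ ∷ _} (p ∷ pwX) pwY       = p ∷ merge-Pointwise pwX pwY
  merge-Pointwise {m = inj₂ _ ∷ _} pwX       (p ∷ pwY) = p ∷ merge-Pointwise pwX pwY

lemma13 : ∀ {ℓ} (X Y : Interface ℓ)
    (r : Pred (List (St X) × List (St Y)) ℓ) → PermInv₂ r →
    (m : List (St X ⊎ St Y)) →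
    bangPT (PT (X & Y)) (r ∘ split) m
    ⇔ tensorPT (bangPT (PT X)) (bangPT (PT Y)) r (split m)
lemma13 X Y r r-perm m = mk⇔ to from
  where
  to : bangPT (PT (X & Y)) (r ∘ split) m →
       tensorPT (bangPT (PT X)) (bangPT (PT Y)) r (split m)
  to (zs , Prod⊆r∘split , pw) =
    SmallProd xs , SmallProd ys , SmallProd×SmallProd⊆r ,
    (xs , Prod⊆SmallProd , restrict₁-Pointwise X Y pw) ,
    (ys , Prod⊆SmallProd , restrict₂-Pointwise X Y pw)
    where
    xs = restrict₁ m zs
    ys = restrict₂ m zs
    SmallProd×SmallProd⊆r : ∀ {as bs} → SmallProd xs as → SmallProd ys bs → r (as , bs)
    SmallProd×SmallProd⊆r (as′ , boxX , as↭as′) (bs′ , boxY , bs↭bs′)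
      with cs , cs∈zs , split-cs ← Box-restrict⇒Pointwise pw boxX boxY
      = r-perm (↭-sym as↭as′) (↭-sym bs↭bs′)
               (subst r split-cs (Prod⊆r∘split (cs , cs∈zs , ↭-refl)))
  from : tensorPT (bangPT (PT X)) (bangPT (PT Y)) r (split m) →
         bangPT (PT (X & Y)) (r ∘ split) m
  from (x , y , x×y⊆r , (xs , Prod⊆x , pwX) , (ys , Prod⊆y , pwY)) =
    merge m xs ys , Prod⊆r∘split , merge-Pointwise X Y pwX pwY
    where
    Prod⊆r∘split : ∀ {cs} → Prod (merge m xs ys) cs → r (split cs)
    Prod⊆r∘split (bs , bs∈zs , cs↭bs)
      with bs∈xs , bs∈ys ← Pointwise-merge⇒split pwX pwY bs∈zs
      = PermInv₂⇒PermInv-∘split r-perm (↭-sym cs↭bs)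
          (x×y⊆r (Prod⊆x (_ , bs∈xs , ↭-refl)) (Prod⊆y (_ , bs∈ys , ↭-refl)))
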